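{- Let $F$ be a forest, and consider a play of the Sweller-start competition-independence game on $F$ in which Sweller follows the greedy strategy described in the context and Diminisher plays arbitrarily; let $N$ be the total number of moves and $r = \lfloor N/2 \rfloor$. Let $i \leq r$ and suppose $v_i^D(w_i^D) = 1+l$ and $e_i^D(w_i^D) = l+p$ for some $l \geq 1$. Then there is $\hat{w}_i^S \in V(F_{i-1}^D)$ such that either $v_i^S(\hat{w}_i^S) = l+1$ and $e_i^S(\hat{w}_i^S) \geq p+l$, or $v_i^S(\hat{w}_i^S) = l+2$ and $e_i^S(\hat{w}_i^S) \geq p+l+2$.
   Context: The game is rephrased as follows: starting from the forest $F$, players alternately pick a vertex $u$ of the current forest $H$ and replace $H$ by $H - N_H[u]$; Sweller moves first and the game ends when the forest is empty. For a graph $G$, $K(G)$ is its number of isolated vertices. Set $F_0^D = F$. For $i \geq 1$, Sweller's $i$-th move is a vertex $w_i^S$ of $F_{i-1}^D$ and $F_i^S = F_{i-1}^D - N[w_i^S]$; Diminisher's $i$-th move is a vertex $w_i^D$ of $F_i^S$ and $F_i^D = F_i^S - N[w_i^D]$. For $u \in V(F_{i-1}^D)$ define $v_i^S(u) = |N_{F_{i-1}^D}[u]|$, $e_i^S(u) = |E(F_{i-1}^D)| - |E(F_{i-1}^D - N[u])|$, $k_i^S(u) = K(F_{i-1}^D - N[u]) - K(F_{i-1}^D)$, and $m_i^S(u) = (1-\beta)k_i^S(u) + v_i^S(u) - \alpha e_i^S(u)$ with $\alpha = 3/8$, $\beta = 13/8$. For $u \in V(F_i^S)$: $v_i^D(u)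 = |N_{F_i^S}[u]|$ and $e_i^D(u) = |E(F_i^S)| - |E(F_i^S - N[u])|$. The greedy strategy: at her $i$-th move Sweller picks any vertex $w_i^S$ of $F_{i-1}^D$ minimizing $m_i^S$. -}

module Defs where

open import Data.Nat as ℕ using (ℕ; zero; suc; _+_; _∸_)
open import Data.Bool using (Bool; true; false; _∧_; _∨_; not; if_then_else_)
open import Data.Fin using (Fin; toℕ; _≟_; _<?_)
open import Data.List using (List; []; _∷_; _++_; length; map; allFin)
open import Data.Nat.ListAction using (sum)
open import Data.List.Relation.Unary.Linked using (Linked)
open import Data.List.Relation.Unary.Unique.Propositional using (Unique)
open import Data.Integer as ℤ using (ℤ; +_)
open import Data.Rational as ℚ using (ℚ; _/_; 1ℚ)
open import Data.Product using (∃)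
open import Relation.Nullary using (¬_)
open import Relation.Nullary.Decidable using (⌊_⌋)
open import Relation.Binary.PropositionalEquality using (_≡_)

record Graph (n : ℕ) : Set where
  field
    adj    : Fin n → Fin n → Bool
    sym    : ∀ u v → adj u v ≡ adj v u
    irrefl : ∀ u → adj u u ≡ false
open Graph public

IsCycle : ∀ {n} → Graph n → List (Fin n) → Set
IsCycle G []       = Data.Empty.⊥ where import Data.Empty
IsCycle G (v ∷ vs) =
  (3 ℕ.≤ length (v ∷ vs)) Data.Product.×
  (Unique (v ∷ vs) Data.Product.×
   Linked (λ a b → adj G a b ≡ true) (v ∷ vs ++ v ∷ []))
  where import Data.Product

IsForest : ∀ {n} → Graph n → Set
IsForest G = ¬ ∃ (IsCycle G)

-- Vertex subsets (the current forest H is the subgraph of F induced on it).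
VSet : ℕ → Set
VSet n = Fin n → Bool

fullSet : ∀ {n} → VSet n
fullSet _ = true

IsEmpty : ∀ {n} → VSet n → Set
IsEmpty S = ∀ v → S v ≡ false

count : ∀ {n} → VSet n → ℕ
count {n} S = sum (map (λ v → if S v then 1 else 0) (allFin n))

closedNbhd : ∀ {n} → Graph n → VSet n → Fin n → VSet n
closedNbhd G S u v = S v ∧ (⌊ v ≟ u ⌋ ∨ adj G u v)

remove : ∀ {n} → Graph n → VSet n → Fin n → VSet n
remove G S u v = S v ∧ not (closedNbhd G S u v)

edges : ∀ {n} → Graph n → VSet n → ℕ
edges {n} G S =
  sum (map (λ u → count (λ v → S u ∧ S v ∧ adj G u v ∧ ⌊ u <? v ⌋)) (allFin n))

K : ∀ {n} → Graph n → VSet n → ℕ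
K G S = count (λ v → S v ∧ (count (λ w → S w ∧ adj G v w) ℕ.≡ᵇ 0))

vval : ∀ {n} → Graph n → VSet n → Fin n → ℕ
vval G S u = count (closedNbhd G S u)

eval : ∀ {n} → Graph n → VSet n → Fin n → ℕ
eval G S u = edges G S ∸ edges G (remove G S u)

kval : ∀ {n} → Graph n → VSet n → Fin n → ℤ
kval G S u = + K G (remove G S u) ℤ.- + K G S

α β : ℚ
α = + 3 / 8
β = + 13 / 8

mval : ∀ {n} → Graph n → VSet n → Fin n → ℚ
mval G S u =
  ((1ℚ ℚ.- β) ℚ.* (kval G S u ℚ./ 1)) ℚ.+ (+ vval G S u / 1)
    ℚ.- (α ℚ.* (+ eval G S u / 1))

-- A play is given by the sequence of moves w 0, w 1, … (0-indexed; the
-- j-th move, j even, is Sweller's, j odd is Diminisher's) and its length N.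
-- state G w j = forest after the first j moves (as vertex set of F).
state : ∀ {n} → Graph n → (ℕ → Fin n) → ℕ → VSet n
state G w zero    = fullSet
state G w (suc j) = remove G (state G w j) (w j)

IsPlay : ∀ {n} → Graph n → (ℕ → Fin n) → ℕ → Set
IsPlay G w N =
  (∀ j → j ℕ.< N → state G w j (w j) ≡ true) Data.Product.×
  IsEmpty (state G w N)
  where import Data.Product

SwellerGreedy : ∀ {n} → Graph n → (ℕ → Fin n) → ℕ → Set
SwellerGreedy G w N =
  ∀ t → 2 ℕ.* t ℕ.< N → ∀ u → state G w (2 ℕ.* t) u ≡ true →
    mval G (state G w (2 ℕ.* t)) (w (2 ℕ.* t))
      ℚ.≤ mval G (state G w (2 ℕ.* t)) u

-- Let S be the forest before Sweller's i-th move s, S′ = S − N[s], and w Diminisher's reply.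
-- Take ŵ = w, now seen in S. The closed neighbourhood of w in S exceeds the one in S′ by the
-- vertices removed with s, i.e. by common neighbours of s and w; a forest has at most one
-- (two would close a 4-cycle). Without one, v(w) is unchanged and e(w) can only grow. With one,
-- x, v(w) grows by 1 and e(w) by at least 2: the edges xs and xw are absent from S′.
module Submission where

open import Defs renaming (sym to adj-sym)
open import Data.Nat using (ℕ; zero; suc; _+_; _*_; _∸_; _≤_; _<_; _/_; z≤n; s≤s)
open import Data.Nat.Properties
  using (≤-trans; +-mono-≤; +-monoʳ-≤; +-comm; +-assoc; +-suc; +-identityʳ;
         m≤m+n; m≤n+m; m+n∸n≡m; *-comm; *-monoʳ-≤; n≤1+n; +-commutativeSemigroup; module ≤-Reasoning)
open import Data.Nat.DivMod using (m/n*n≤m)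
open import Data.Nat.ListAction using (sum)
open import Algebra.Properties.CommutativeSemigroup +-commutativeSemigroup using (interchange)
open import Data.Bool as Bool using (Bool; true; false; _∧_; _∨_; not; if_then_else_)
open import Data.Bool.Properties using (∧-assoc; ∧-comm; ∨-comm; not-injective; ¬-not)
open import Data.Fin as Fin using (Fin; _≟_; _<?_)
open import Data.Fin.Properties using (<-cmp; any?; suc-injective)
open import Data.List using ([]; _∷_; map; allFin)
open import Data.List.Properties using (map-cong; map-tabulate)
open import Data.List.Membership.Propositional using (_∈_)
open import Data.List.Membership.Propositional.Properties using (∈-allFin)
open import Data.List.Relation.Unary.Any using (here; there)
open import Data.List.Relation.Unary.All using ([]; _∷_)
open import Data.List.Relation.Unary.AllPairs using ([]; _∷_)
open import Data.List.Relation.Unary.Linked using ([-]; _∷_)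
open import Data.Product using (∃; _×_; _,_; proj₁; proj₂)
open import Data.Sum using (_⊎_; inj₁; inj₂)
open import Data.Empty using (⊥-elim)
open import Function using (id; _∘_; case_of_)
open import Relation.Nullary using (¬_; Dec; yes; no)
open import Relation.Nullary.Decidable using (⌊_⌋; isYes≗does; dec-true; dec-false)
open import Relation.Binary.Definitions using (tri<; tri≈; tri>)
open import Relation.Binary.PropositionalEquality
  using (_≡_; _≢_; refl; sym; trans; cong; cong₂; subst; module ≡-Reasoning)

∧-elim : ∀ {a b} → a ∧ b ≡ true → a ≡ true × b ≡ true
∧-elim {true} b≡true = refl , b≡true

∧-intro : ∀ {a b} → a ≡ true → b ≡ true → a ∧ b ≡ true
∧-intro refl b≡true = b≡true

not-true : ∀ {b} → not b ≡ true → b ≡ false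
not-true {false} _ = refl

⌊⌋-true : ∀ {A : Set} (a? : Dec A) → A → ⌊ a? ⌋ ≡ true
⌊⌋-true a? a = trans (isYes≗does a?) (dec-true a? a)

⌊⌋-false : ∀ {A : Set} (a? : Dec A) → ¬ A → ⌊ a? ⌋ ≡ false
⌊⌋-false a? ¬a = trans (isYes≗does a?) (dec-false a? ¬a)

⌊⌋-∨ : ∀ {A : Set} (a? : Dec A) {b} → ⌊ a? ⌋ ∨ b ≡ true → A ⊎ b ≡ true
⌊⌋-∨ (yes a) _ = inj₁ a
⌊⌋-∨ (no _) b≡true = inj₂ b≡true

⌊⌋-∨-false : ∀ {A : Set} (a? : Dec A) {b} → ⌊ a? ⌋ ∨ b ≡ false → ¬ A × b ≡ false
⌊⌋-∨-false (no ¬a) b≡false = ¬a , b≡false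

sum-map-+ : ∀ {A : Set} (f g : A → ℕ) xs →
  sum (map (λ x → f x + g x) xs) ≡ sum (map f xs) + sum (map g xs)
sum-map-+ f g [] = refl
sum-map-+ f g (x ∷ xs) = trans (cong (f x + g x +_) (sum-map-+ f g xs))
                               (interchange (f x) (g x) _ _)

∈⇒≤sum-map : ∀ {A : Set} (f : A → ℕ) {x xs} → x ∈ xs → f x ≤ sum (map f xs)
∈⇒≤sum-map f {xs = y ∷ ys} (here refl) = m≤m+n (f y) _
∈⇒≤sum-map f {xs = y ∷ ys} (there x∈ys) = ≤-trans (∈⇒≤sum-map f x∈ys) (m≤n+m _ (f y))

∑ : ∀ {n} → (Fin n → ℕ) → ℕ
∑ f = sum (map f (allFin _))

module _ {n : ℕ} where

  ∑-cong : ∀ {f g : Fin n → ℕ} → (∀ x → f x ≡ g x) → ∑ f ≡ ∑ g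
  ∑-cong f≡g = cong sum (map-cong f≡g (allFin n))

  ∑-+ : ∀ (f g : Fin n → ℕ) → ∑ (λ x → f x + g x) ≡ ∑ f + ∑ g
  ∑-+ f g = sum-map-+ f g (allFin n)

  ≤∑ : ∀ (f : Fin n → ℕ) x → f x ≤ ∑ f
  ≤∑ f x = ∈⇒≤sum-map f (∈-allFin x)

∑-suc : ∀ {n} (f : Fin (suc n) → ℕ) → ∑ f ≡ f Fin.zero + ∑ (f ∘ Fin.suc)
∑-suc f = cong (f Fin.zero +_)
  (cong sum (trans (map-tabulate Fin.suc f) (sym (map-tabulate id (f ∘ Fin.suc)))))

indicator : Bool → ℕ
indicator b = if b then 1 else 0

module _ {n : ℕ} where

  count-cong : ∀ {P Q : VSet n} → (∀ v → P v ≡ Q v) → count P ≡ count Q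
  count-cong P≡Q = ∑-cong (cong indicator ∘ P≡Q)

  count-split : ∀ (P Q : VSet n) →
    count P ≡ count (λ v → Q v ∧ P v) + count (λ v → not (Q v) ∧ P v)
  count-split P Q = trans (∑-cong (λ v → split (Q v) (P v)))
    (∑-+ (λ v → indicator (Q v ∧ P v)) (λ v → indicator (not (Q v) ∧ P v)))
    where
    split : ∀ q p → indicator p ≡ indicator (q ∧ p) + indicator (not q ∧ p)
    split true p = sym (+-identityʳ (indicator p))
    split false p = refl

  count-member : ∀ {P : VSet n} x → P x ≡ true → 1 ≤ count P
  count-member {P} x Px≡true = subst (_≤ count P) (cong indicator Px≡true) (≤∑ (indicator ∘ P) x)

count-none : ∀ {n} {P : VSet n} → (∀ v → P v ≡ false) → count P ≡ 0
count-none {zero} _ = refl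
count-none {suc n} {P} P≡false =
  trans (∑-suc (indicator ∘ P)) (cong₂ _+_ (cong indicator (P≡false Fin.zero))
                                           (count-none (P≡false ∘ Fin.suc)))

count-unique : ∀ {n} {P : VSet n} x → P x ≡ true → (∀ v → P v ≡ true → v ≡ x) → count P ≡ 1
count-unique {suc n} {P} Fin.zero Px≡true unique =
  trans (∑-suc (indicator ∘ P)) (cong₂ _+_ (cong indicator Px≡true) (count-none P∘suc≡false))
  where
  P∘suc≡false : ∀ v → P (Fin.suc v) ≡ false
  P∘suc≡false v with P (Fin.suc v) in eq
  ... | true = case unique (Fin.suc v) eq of λ ()
  ... | false = refl
count-unique {suc n} {P} (Fin.suc x) Px≡true unique =
  trans (∑-suc (indicator ∘ P)) (cong₂ _+_ (cong indicator P0≡false)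
    (count-unique x Px≡true (λ v Psv → suc-injective (unique (Fin.suc v) Psv))))
  where
  P0≡false : P Fin.zero ≡ false
  P0≡false with P Fin.zero in eq
  ... | true = case unique Fin.zero eq of λ ()
  ... | false = refl

pairs : ∀ {n} → (Fin n → Fin n → Bool) → ℕ
pairs R = ∑ λ a → count (R a)

module _ {n : ℕ} where

  pairs-cong : ∀ {R R′ : Fin n → Fin n → Bool} → (∀ a b → R a b ≡ R′ a b) → pairs R ≡ pairs R′
  pairs-cong R≡R′ = ∑-cong (λ a → count-cong (R≡R′ a))

  pairs-split : ∀ (R Q : Fin n → Fin n → Bool) →
    pairs R ≡ pairs (λ a b → Q a b ∧ R a b) + pairs (λ a b → not (Q a b) ∧ R a b)
  pairs-split R Q = trans (∑-cong (λ a → count-split (R a) (Q a)))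
    (∑-+ (λ a → count (λ b → Q a b ∧ R a b)) (λ a → count (λ b → not (Q a b) ∧ R a b)))

  pairs-member : ∀ {R : Fin n → Fin n → Bool} a b → R a b ≡ true → 1 ≤ pairs R
  pairs-member {R} a b Rab≡true = ≤-trans (count-member b Rab≡true) (≤∑ (λ a → count (R a)) a)

_⊆_ : ∀ {n} → VSet n → VSet n → Set
T ⊆ S = ∀ v → T v ≡ true → S v ≡ true

either both : ∀ {n} → VSet n → Fin n → Fin n → Bool
either M a b = M a ∨ M b
both M a b = M a ∧ M b

module _ {n : ℕ} (G : Graph n) where

  -- Chosen so that edges G S is pairs (isEdge S) by definition.
  isEdge : VSet n → Fin n → Fin n → Bool
  isEdge S a b = S a ∧ S b ∧ adj G a b ∧ ⌊ a <? b ⌋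

  edgesWhere : VSet n → (Fin n → Fin n → Bool) → ℕ
  edgesWhere S R = pairs (λ a b → R a b ∧ isEdge S a b)

  edgesWhere-split : ∀ S R Q → edgesWhere S R ≡
    edgesWhere S (λ a b → Q a b ∧ R a b) + edgesWhere S (λ a b → not (Q a b) ∧ R a b)
  edgesWhere-split S R Q = trans (pairs-split (λ a b → R a b ∧ isEdge S a b) Q)
    (cong₂ _+_ (pairs-cong (λ a b → sym (∧-assoc (Q a b) _ _)))
               (pairs-cong (λ a b → sym (∧-assoc (not (Q a b)) _ _))))

  eval≡edgesWhere : ∀ S u → eval G S u ≡ edgesWhere S (either (closedNbhd G S u))
  eval≡edgesWhere S u = begin
    edges G S ∸ edges G (remove G S u)
      ≡⟨ cong (_∸ edges G (remove G S u)) (pairs-split (isEdge S) (either N)) ⟩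
    edgesWhere S (either N) + pairs (λ a b → not (either N a b) ∧ isEdge S a b)
      ∸ edges G (remove G S u)
      ≡⟨ cong (λ k → edgesWhere S (either N) + k ∸ edges G (remove G S u)) (pairs-cong untouched) ⟩
    edgesWhere S (either N) + edges G (remove G S u) ∸ edges G (remove G S u)
      ≡⟨ m+n∸n≡m (edgesWhere S (either N)) (edges G (remove G S u)) ⟩
    edgesWhere S (either N) ∎
    where
    open ≡-Reasoning
    N = closedNbhd G S u
    untouched : ∀ a b → not (either N a b) ∧ isEdge S a b ≡ isEdge (remove G S u) a b
    untouched a b = go (S a) (S b) (⌊ a ≟ u ⌋ ∨ adj G u a) (⌊ b ≟ u ⌋ ∨ adj G u b) _
      where
      go : ∀ sa sb ma mb r → not (sa ∧ ma ∨ sb ∧ mb) ∧ (sa ∧ sb ∧ r)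
                           ≡ (sa ∧ not (sa ∧ ma)) ∧ (sb ∧ not (sb ∧ mb)) ∧ r
      go false false ma mb r = refl
      go false true ma true r = refl
      go false true ma false r = refl
      go true sb true mb r = refl
      go true false false mb r = refl
      go true true false mb r = refl

  vval-restrict : ∀ {S T} u → T ⊆ S →
    vval G S u ≡ vval G T u + count (λ v → not (T v) ∧ closedNbhd G S u v)
  vval-restrict {S} {T} u T⊆S = trans (count-split (closedNbhd G S u) T)
    (cong (_+ count (λ v → not (T v) ∧ closedNbhd G S u v))
          (count-cong (λ v → go (T v) (⌊ v ≟ u ⌋ ∨ adj G u v) (T⊆S v))))
    where
    go : ∀ {s} t m → (t ≡ true → s ≡ true) → t ∧ (s ∧ m) ≡ t ∧ m
    go false m _ = refl
    go true m t⇒s rewrite t⇒s refl = refl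

  eval-restrict : ∀ {S T} u → T ⊆ S → eval G S u ≡
    eval G T u + edgesWhere S (λ a b → not (both T a b) ∧ either (closedNbhd G S u) a b)
  eval-restrict {S} {T} u T⊆S = begin
    eval G S u
      ≡⟨ eval≡edgesWhere S u ⟩
    edgesWhere S (either N)
      ≡⟨ edgesWhere-split S (either N) (both T) ⟩
    edgesWhere S (λ a b → both T a b ∧ either N a b) + lost
      ≡⟨ cong (_+ lost) (pairs-cong kept) ⟩
    edgesWhere T (either (closedNbhd G T u)) + lost
      ≡⟨ cong (_+ lost) (eval≡edgesWhere T u) ⟨
    eval G T u + lost ∎
    where
    open ≡-Reasoning
    N = closedNbhd G S u
    lost = edgesWhere S (λ a b → not (both T a b) ∧ either N a b)
    kept : ∀ a b → (both T a b ∧ either N a b) ∧ isEdge S a b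
                 ≡ either (closedNbhd G T u) a b ∧ isEdge T a b
    kept a b = go (T a) (T b) (⌊ a ≟ u ⌋ ∨ adj G u a) (⌊ b ≟ u ⌋ ∨ adj G u b) _
                  (T⊆S a) (T⊆S b)
      where
      go : ∀ {sa sb} ta tb ma mb r → (ta ≡ true → sa ≡ true) → (tb ≡ true → sb ≡ true) →
        ((ta ∧ tb) ∧ (sa ∧ ma ∨ sb ∧ mb)) ∧ (sa ∧ sb ∧ r) ≡ (ta ∧ ma ∨ tb ∧ mb) ∧ (ta ∧ tb ∧ r)
      go false false ma mb r _ _ = refl
      go false true ma true r _ _ = refl
      go false true ma false r _ _ = refl
      go true false true mb r _ _ = refl
      go true false false mb r _ _ = refl
      go true true ma mb r ta⇒sa tb⇒sb rewrite ta⇒sa refl | tb⇒sb refl = refl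

  adj⇒≢ : ∀ {a b} → adj G a b ≡ true → a ≢ b
  adj⇒≢ {a} ab≡true refl = case trans (sym ab≡true) (irrefl G a) of λ ()

  adj-flip : ∀ {a b} → adj G a b ≡ true → adj G b a ≡ true
  adj-flip {a} {b} ab≡true = trans (adj-sym G b a) ab≡true

  edgesWhere-member : ∀ {S R a b} → (∀ a b → R a b ≡ R b a) →
    S a ≡ true → S b ≡ true → adj G a b ≡ true → R a b ≡ true → 1 ≤ edgesWhere S R
  edgesWhere-member {S} {R} {a} {b} R-comm Sa Sb ab Rab with <-cmp a b
  ... | tri< a<b _ _ = pairs-member a b
          (∧-intro Rab (∧-intro Sa (∧-intro Sb (∧-intro ab (⌊⌋-true (a <? b) a<b)))))
  ... | tri≈ _ a≡b _ = ⊥-elim (adj⇒≢ ab a≡b)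
  ... | tri> _ _ b<a = pairs-member b a
          (∧-intro (trans (R-comm b a) Rab)
            (∧-intro Sb (∧-intro Sa (∧-intro (adj-flip ab) (⌊⌋-true (b <? a) b<a)))))

  forest-common-neighbour : IsForest G → ∀ {a b x y} → a ≢ b →
    adj G a x ≡ true → adj G b x ≡ true → adj G a y ≡ true → adj G b y ≡ true → x ≡ y
  forest-common-neighbour forest {a} {b} {x} {y} a≢b ax bx ay by with x ≟ y
  ... | yes x≡y = x≡y
  ... | no x≢y = ⊥-elim (forest (a ∷ x ∷ b ∷ y ∷ [] , s≤s (s≤s (s≤s z≤n)) , distinct , closed))
    where
    distinct = (adj⇒≢ ax ∷ a≢b ∷ adj⇒≢ ay ∷ [])
             ∷ (adj⇒≢ (adj-flip bx) ∷ x≢y ∷ [])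
             ∷ (adj⇒≢ by ∷ [])
             ∷ [] ∷ []
    closed = ax ∷ adj-flip bx ∷ by ∷ adj-flip ay ∷ [-]

  closedNbhd-true : ∀ {S u v} → closedNbhd G S u v ≡ true → S v ≡ true × (v ≡ u ⊎ adj G u v ≡ true)
  closedNbhd-true {S} {u} {v} h = proj₁ (∧-elim h) , ⌊⌋-∨ (v ≟ u) (proj₂ (∧-elim {S v} h))

  remove⊆ : ∀ {S} u → remove G S u ⊆ S
  remove⊆ u v h = proj₁ (∧-elim h)

  remove-true : ∀ {S u v} → remove G S u v ≡ true → v ≢ u × adj G u v ≡ false
  remove-true {S} {u} {v} h = ⌊⌋-∨-false (v ≟ u)
    (subst (λ sv → sv ∧ (⌊ v ≟ u ⌋ ∨ adj G u v) ≡ false) Sv (not-true notN))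
    where
    Sv = proj₁ (∧-elim h)
    notN = proj₂ (∧-elim {S v} h)

  remove-false : ∀ {S u v} → S v ≡ true → remove G S u v ≡ false → v ≡ u ⊎ adj G u v ≡ true
  remove-false {S} {u} {v} Sv h = ⌊⌋-∨ (v ≟ u) (not-injective {y = true}
    (subst (λ sv → sv ∧ not (sv ∧ (⌊ v ≟ u ⌋ ∨ adj G u v)) ≡ false) Sv h))

module SwellerMove {n} {G : Graph n} (forest : IsForest G) {S : VSet n} {s w : Fin n}
                    (s∈S : S s ≡ true) (w∈S′ : remove G S s w ≡ true) where

  S′ : VSet n
  S′ = remove G S s

  N : VSet n
  N = closedNbhd G S w

  lost : VSet n
  lost v = not (S′ v) ∧ N v

  w≢s : w ≢ s
  w≢s = proj₁ (remove-true G {S} {s} {w} w∈S′)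

  s≁w : adj G s w ≡ false
  s≁w = proj₂ (remove-true G {S} {s} {w} w∈S′)

  lost-true : ∀ {v} → lost v ≡ true → S′ v ≡ false × N v ≡ true
  lost-true {v} h = not-true (proj₁ (∧-elim h)) , proj₂ (∧-elim {not (S′ v)} h)

  lost⇒common-neighbour : ∀ {v} → lost v ≡ true → adj G s v ≡ true × adj G w v ≡ true
  lost⇒common-neighbour {v} h with closedNbhd-true G {S} {w} {v} (proj₂ (lost-true h))
  ... | Sv , inj₁ refl = case trans (sym (proj₁ (lost-true h))) w∈S′ of λ ()
  ... | Sv , inj₂ wv with remove-false G {S} {s} {v} Sv (proj₁ (lost-true h))
  ...   | inj₁ refl = case trans (sym s≁w) (adj-flip G wv) of λ ()
  ...   | inj₂ sv = sv , wv

  lost-unique : ∀ {x y} → lost x ≡ true → lost y ≡ true → y ≡ x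
  lost-unique x-lost y-lost =
    forest-common-neighbour G forest (w≢s ∘ sym) (proj₁ y′) (proj₂ y′) (proj₁ x′) (proj₂ x′)
    where
    x′ = lost⇒common-neighbour x-lost
    y′ = lost⇒common-neighbour y-lost

  lostEdges : ℕ
  lostEdges = edgesWhere G S (λ a b → not (both S′ a b) ∧ either N a b)

  vval-after : vval G S w ≡ vval G S′ w + count lost
  vval-after = vval-restrict G w (remove⊆ G {S} s)

  eval-after : eval G S w ≡ eval G S′ w + lostEdges
  eval-after = eval-restrict G w (remove⊆ G {S} s)

  lostEdges≥2 : ∀ {x} → lost x ≡ true → 2 ≤ lostEdges
  lostEdges≥2 {x} x-lost = subst (2 ≤_) (sym (edgesWhere-split G S R touchesS))
    (+-mono-≤ (edgesWhere-member G R₁-comm Sx s∈S (adj-flip G sx) edge-xs)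
              (edgesWhere-member G R₂-comm Sx w∈S (adj-flip G wx) edge-xw))
    where
    R touchesS : Fin n → Fin n → Bool
    R a b = not (both S′ a b) ∧ either N a b
    touchesS = either (λ v → ⌊ v ≟ s ⌋)

    R-comm : ∀ a b → R a b ≡ R b a
    R-comm a b = cong₂ _∧_ (cong not (∧-comm (S′ a) (S′ b))) (∨-comm (N a) (N b))
    R₁-comm : ∀ a b → touchesS a b ∧ R a b ≡ touchesS b a ∧ R b a
    R₁-comm a b = cong₂ _∧_ (∨-comm ⌊ a ≟ s ⌋ ⌊ b ≟ s ⌋) (R-comm a b)
    R₂-comm : ∀ a b → not (touchesS a b) ∧ R a b ≡ not (touchesS b a) ∧ R b a
    R₂-comm a b = cong₂ _∧_ (cong not (∨-comm ⌊ a ≟ s ⌋ ⌊ b ≟ s ⌋)) (R-comm a b)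

    sx = proj₁ (lost⇒common-neighbour x-lost)
    wx = proj₂ (lost⇒common-neighbour x-lost)
    x∈N = proj₂ (lost-true x-lost)
    Sx = proj₁ (closedNbhd-true G {S} {w} {x} x∈N)
    w∈S = remove⊆ G {S} s w w∈S′
    x≢s = adj⇒≢ G sx ∘ sym

    R-from-x : ∀ b → R x b ≡ true
    R-from-x b = cong₂ (λ s′x nx → not (s′x ∧ S′ b) ∧ (nx ∨ N b))
                       (proj₁ (lost-true x-lost)) x∈N
    edge-xs : touchesS x s ∧ R x s ≡ true
    edge-xs = ∧-intro (trans (cong (_∨ ⌊ s ≟ s ⌋) (⌊⌋-false (x ≟ s) x≢s)) (⌊⌋-true (s ≟ s) refl))
                      (R-from-x s)
    edge-xw : not (touchesS x w) ∧ R x w ≡ true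
    edge-xw = ∧-intro (cong₂ (λ xs ws → not (xs ∨ ws)) (⌊⌋-false (x ≟ s) x≢s) (⌊⌋-false (w ≟ s) w≢s))
                      (R-from-x w)

  vval-eval-dichotomy : ∀ l p → vval G S′ w ≡ 1 + l → eval G S′ w ≡ l + p →
    (vval G S w ≡ l + 1 × p + l ≤ eval G S w) ⊎ (vval G S w ≡ l + 2 × p + l + 2 ≤ eval G S w)
  vval-eval-dichotomy l p v′≡1+l e′≡l+p with any? (λ x → lost x Bool.≟ true)
  ... | no no-lost = inj₁ (vval≡ , eval≥)
    where
    vval≡ : vval G S w ≡ l + 1
    vval≡ = begin
      vval G S w                ≡⟨ vval-after ⟩
      vval G S′ w + count lost  ≡⟨ cong₂ _+_ v′≡1+l (count-none (λ v → ¬-not (no-lost ∘ (v ,_)))) ⟩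
      1 + l + 0                 ≡⟨ +-identityʳ (1 + l) ⟩
      1 + l                     ≡⟨ +-comm 1 l ⟩
      l + 1                     ∎
      where open ≡-Reasoning
    eval≥ : p + l ≤ eval G S w
    eval≥ = begin
      p + l                      ≡⟨ trans (+-comm p l) (sym e′≡l+p) ⟩
      eval G S′ w                ≤⟨ m≤m+n (eval G S′ w) lostEdges ⟩
      eval G S′ w + lostEdges    ≡⟨ eval-after ⟨
      eval G S w                 ∎
      where open ≤-Reasoning
  ... | yes (x , x-lost) = inj₂ (vval≡ , eval≥)
    where
    vval≡ : vval G S w ≡ l + 2
    vval≡ = begin
      vval G S w                ≡⟨ vval-after ⟩
      vval G S′ w + count lost  ≡⟨ cong₂ _+_ v′≡1+l (count-unique x x-lost (λ _ → lost-unique x-lost)) ⟩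
      1 + l + 1                 ≡⟨ cong (_+ 1) (+-comm 1 l) ⟩
      l + 1 + 1                 ≡⟨ +-assoc l 1 1 ⟩
      l + 2                     ∎
      where open ≡-Reasoning
    eval≥ : p + l + 2 ≤ eval G S w
    eval≥ = begin
      p + l + 2                  ≡⟨ cong (_+ 2) (trans (+-comm p l) (sym e′≡l+p)) ⟩
      eval G S′ w + 2            ≤⟨ +-monoʳ-≤ (eval G S′ w) (lostEdges≥2 x-lost) ⟩
      eval G S′ w + lostEdges    ≡⟨ eval-after ⟨
      eval G S w                 ∎
      where open ≤-Reasoning

lemma3 : ∀ {n} (F : Graph n) → IsForest F →
    (w : ℕ → Fin n) (N : ℕ) → IsPlay F w N → SwellerGreedy F w N →
    ∀ (i l p : ℕ) → 1 ≤ i → i ≤ N / 2 → 1 ≤ l →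
    vval F (state F w (2 * i ∸ 1)) (w (2 * i ∸ 1)) ≡ 1 + l →
    eval F (state F w (2 * i ∸ 1)) (w (2 * i ∸ 1)) ≡ l + p →
    ∃ λ (ŵ : Fin n) → state F w (2 * (i ∸ 1)) ŵ ≡ true ×
      ((vval F (state F w (2 * (i ∸ 1))) ŵ ≡ l + 1 ×
        p + l ≤ eval F (state F w (2 * (i ∸ 1))) ŵ)
       ⊎ (vval F (state F w (2 * (i ∸ 1))) ŵ ≡ l + 2 ×
        p + l + 2 ≤ eval F (state F w (2 * (i ∸ 1))) ŵ))
lemma3 _ _ _ _ _ _ zero _ _ () _ _ _ _
lemma3 F forest w N (legal , _) _ (suc k) l p _ i≤N/2 _ v≡1+l e≡l+p =
  w (suc j) , remove⊆ F {state F w j} (w j) (w (suc j)) ŵ-legal ,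
  SwellerMove.vval-eval-dichotomy forest (legal j (≤-trans (n≤1+n (suc j)) suc-j<N)) ŵ-legal l p
    (subst (λ m → vval F (state F w m) (w m) ≡ 1 + l) diminisher-move v≡1+l)
    (subst (λ m → eval F (state F w m) (w m) ≡ l + p) diminisher-move e≡l+p)
  where
  j = 2 * k
  diminisher-move : 2 * suc k ∸ 1 ≡ suc j
  diminisher-move = +-suc k (k + 0)
  suc-j<N : suc j < N
  suc-j<N = subst (_≤ N) (cong suc diminisher-move)
    (≤-trans (*-monoʳ-≤ 2 i≤N/2) (subst (_≤ N) (*-comm (N / 2) 2) (m/n*n≤m N 2)))
  ŵ-legal = legal (suc j) suc-j<N
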